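{- Let $L_n(x)=\sum_{k=0}^n(-1)^k\binom{n}{k}\frac{x^k}{k!}$ be the $n$-th Laguerre polynomial, and define polynomials $\mathcal{L}_n(x)$ by $\mathcal{L}_0(x)=1$, $\mathcal{L}_1(x)=x-1$, and $\mathcal{L}_n(x)=\sum_{j=2}^n\binom{n-2}{j-2}\frac{x^j}{j!}$ for $n>1$. Then for all integers $n>m\ge0$, $$\sum_{j=m}^{n}L_{n-j}(x)\,\mathcal{L}_{j-m}(x)=0,$$ and consequently, as infinite lower triangular matrices, $\left[L_{n-j}(x)\right]^{ -1}=\left[\mathcal{L}_{n-j}(x)\right]$.
   Context: Matrices $[a_{n,j}]$ are infinite lower triangular matrices indexed by $n\ge j\ge0$ (entries with $j>n$ are zero), multiplied by the ordinary matrix product; the inverse is the two-sided inverse in this ring. The Laguerre polynomials have generating function $\sum_{n\ge0}t^nL_n(x)=\frac{1}{1-t}\exp\!\left(-\frac{tx}{1-t}\right)$.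
   Formalization: The variable x ranges over ℚ instead of the reals, so the matrices $\left[L_{n-j}(x)\right]$ and $\left[\mathcal{L}_{n-j}(x)\right]$ have rational entries. -}

module Defs where

open import Data.Nat as ℕ using (ℕ; zero; suc; _∸_; _≤_; _<_; _!; _≤?_)
open import Data.Nat.Properties using (_!≢0)
open import Data.Nat.Combinatorics using (_C_)
open import Data.Integer as ℤ using (ℤ; +_)
open import Data.Rational using (ℚ; 0ℚ; 1ℚ; _+_; _*_; -_; _-_; _/_)
open import Relation.Nullary using (yes; no)

_^_ : ℚ → ℕ → ℚ
x ^ zero = 1ℚ
x ^ suc k = x * (x ^ k)

sgn : ℕ → ℚ
sgn zero = 1ℚ
sgn (suc k) = - sgn k

toℚ : ℕ → ℚ
toℚ n = (+ n) / 1

inv! : ℕ → ℚ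
inv! k = ((+ 1) / (k !)) {{k !≢0}}

Σ< : ℕ → (ℕ → ℚ) → ℚ
Σ< zero f = 0ℚ
Σ< (suc k) f = Σ< k f + f k

Σ[_to_] : ℕ → ℕ → (ℕ → ℚ) → ℚ
Σ[ m to n ] f with m ≤? n
... | yes _ = Σ< (suc (n ∸ m)) (λ i → f (m ℕ.+ i))
... | no _ = 0ℚ

L : ℕ → ℚ → ℚ
L n x = Σ[ 0 to n ] (λ k → sgn k * toℚ (n C k) * (x ^ k) * inv! k)

𝓛 : ℕ → ℚ → ℚ
𝓛 zero x = 1ℚ
𝓛 (suc zero) x = x - 1ℚ
𝓛 (suc (suc n)) x = Σ[ 2 to suc (suc n) ] (λ j → toℚ (n C (j ∸ 2)) * (x ^ j) * inv! j)

-- infinite lower triangular matrices over ℚ, indexed by n ≥ j ≥ 0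
-- (entry (n , j); entries with j > n are regarded as zero)
Matrix : Set
Matrix = ℕ → ℕ → ℚ

_⊗_ : Matrix → Matrix → Matrix
(A ⊗ B) n m = Σ[ m to n ] (λ j → A n j * B j m)

I : Matrix
I n m with n ℕ.≟ m
... | yes _ = 1ℚ
... | no _ = 0ℚ

toeplitz : (ℕ → ℚ) → Matrix
toeplitz f n j with j ≤? n
... | yes _ = f (n ∸ j)
... | no _ = 0ℚ

_≐_ : Matrix → Matrix → Set
A ≐ B = ∀ n j → j ≤ n → A n j ≡ B n j
  where open import Relation.Binary.PropositionalEquality using (_≡_)

IsInverse : Matrix → Matrix → Set
IsInverse A B = ((A ⊗ B) ≐ I) × ((B ⊗ A) ≐ I)
  where open import Data.Product using (_×_)

-- With u = t/(1−t), the generating functions are Σ Lₙ(x) tⁿ = e^(−xu)/(1−t) and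
-- Σ 𝓛ₙ(x) tⁿ = (1−t) e^(xu), whose product is 1. Coefficientwise: expanding both
-- polynomials in powers of x, the coefficient of xᵃ·xᵇ in Σᵢ L_{N−i} 𝓛ᵢ is
-- (−1)ᵃ/(a! b!) · [tᴺ] u^(a+b) by a Vandermonde convolution, and grouping the terms by
-- s = a + b leaves [tᴺ] uˢ · (1 − 1)ˢ/s!, which vanishes unless s = 0. So the
-- convolution is [tᴺ] u⁰ = δ_{N,0}, which gives the orthogonality relation and the
-- inverse pair of Toeplitz matrices at once.

module Submission where

open import Defs
open import Data.Nat as ℕ using (ℕ; zero; suc; _∸_; _≤_; _<_; _!; z≤n; s≤s; _≤?_)
import Data.Nat.Properties as ℕ
open import Data.Nat.Combinatorics
  using (_C_; k>n⇒nCk≡0; nCk+nC[k+1]≡[n+1]C[k+1]; nCk≡n!/k![n-k]!; k![n∸k]!∣n!)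
open import Data.Nat.DivMod using (m/n*n≡m)
import Data.Integer as ℤ
import Data.Integer.Properties as ℤ
open import Data.Rational using (ℚ; 0ℚ; 1ℚ; _+_; _*_; -_; _-_; _/_; toℚᵘ)
open import Data.Rational.Properties
  using (toℚᵘ-injective; toℚᵘ-fromℚᵘ; toℚᵘ-homo-+; toℚᵘ-homo-*;
         +-identityˡ; +-identityʳ; +-assoc; +-comm; *-identityˡ; *-zeroˡ; *-zeroʳ;
         *-assoc; *-distribˡ-+; *-distribʳ-+; *-comm)
import Data.Rational.Unnormalised as ℚᵘ
import Data.Rational.Unnormalised.Properties as ℚᵘ
open import Data.Rational.Solver using (module +-*-Solver)
open import Data.Product using (_×_; _,_)
open import Relation.Binary.PropositionalEquality
open import Relation.Nullary using (yes; no)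
open import Relation.Nullary.Negation using (contradiction)
open import Function using (_∘_)

open +-*-Solver

toℚᵘ-toℚ : ∀ n → toℚᵘ (toℚ n) ℚᵘ.≃ ℤ.+ n ℚᵘ./ 1
toℚᵘ-toℚ n = toℚᵘ-fromℚᵘ (ℤ.+ n ℚᵘ./ 1)

toℚ-+ : ∀ m n → toℚ (m ℕ.+ n) ≡ toℚ m + toℚ n
toℚ-+ m n = toℚᵘ-injective (begin
  toℚᵘ (toℚ (m ℕ.+ n))                ≈⟨ toℚᵘ-toℚ (m ℕ.+ n) ⟩
  ℤ.+ (m ℕ.+ n) ℚᵘ./ 1                ≈⟨ ℚᵘ.*≡* (cong (ℤ._* ℤ.+ 1) (trans (ℤ.pos-+ m n)
                                           (sym (cong₂ ℤ._+_ (ℤ.*-identityʳ (ℤ.+ m)) (ℤ.*-identityʳ (ℤ.+ n)))))) ⟩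
  ℤ.+ m ℚᵘ./ 1 ℚᵘ.+ ℤ.+ n ℚᵘ./ 1      ≈⟨ ℚᵘ.+-cong (ℚᵘ.≃-sym (toℚᵘ-toℚ m)) (ℚᵘ.≃-sym (toℚᵘ-toℚ n)) ⟩
  toℚᵘ (toℚ m) ℚᵘ.+ toℚᵘ (toℚ n)      ≈⟨ ℚᵘ.≃-sym (toℚᵘ-homo-+ (toℚ m) (toℚ n)) ⟩
  toℚᵘ (toℚ m + toℚ n)                ∎)
  where open ℚᵘ.≃-Reasoning

toℚ-* : ∀ m n → toℚ (m ℕ.* n) ≡ toℚ m * toℚ n
toℚ-* m n = toℚᵘ-injective (begin
  toℚᵘ (toℚ (m ℕ.* n))                    ≈⟨ toℚᵘ-toℚ (m ℕ.* n) ⟩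
  ℤ.+ (m ℕ.* n) ℚᵘ./ 1                    ≈⟨ ℚᵘ.*≡* (cong (ℤ._* ℤ.+ 1) (ℤ.pos-* m n)) ⟩
  (ℤ.+ m ℚᵘ./ 1) ℚᵘ.* (ℤ.+ n ℚᵘ./ 1)      ≈⟨ ℚᵘ.*-cong (ℚᵘ.≃-sym (toℚᵘ-toℚ m)) (ℚᵘ.≃-sym (toℚᵘ-toℚ n)) ⟩
  toℚᵘ (toℚ m) ℚᵘ.* toℚᵘ (toℚ n)          ≈⟨ ℚᵘ.≃-sym (toℚᵘ-homo-* (toℚ m) (toℚ n)) ⟩
  toℚᵘ (toℚ m * toℚ n)                    ∎)
  where open ℚᵘ.≃-Reasoning

toℚ*1/≡1 : ∀ d .{{_ : ℕ.NonZero d}} → toℚ d * (ℤ.+ 1 / d) ≡ 1ℚ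
toℚ*1/≡1 (suc p) = toℚᵘ-injective (begin
  toℚᵘ (toℚ (suc p) * (ℤ.+ 1 / suc p))             ≈⟨ toℚᵘ-homo-* (toℚ (suc p)) (ℤ.+ 1 / suc p) ⟩
  toℚᵘ (toℚ (suc p)) ℚᵘ.* toℚᵘ (ℤ.+ 1 / suc p)    ≈⟨ ℚᵘ.*-cong (toℚᵘ-toℚ (suc p)) (toℚᵘ-fromℚᵘ (ℤ.+ 1 ℚᵘ./ suc p)) ⟩
  (ℤ.+ suc p ℚᵘ./ 1) ℚᵘ.* (ℤ.+ 1 ℚᵘ./ suc p)      ≈⟨ ℚᵘ.*≡* (trans (ℤ.*-identityʳ _) (trans (ℤ.*-identityʳ _)
                                                       (trans (cong ℤ.+_ (sym (ℕ.*-identityˡ (suc p)))) (sym (ℤ.*-identityˡ _))))) ⟩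
  toℚᵘ 1ℚ                                         ∎)
  where open ℚᵘ.≃-Reasoning

toℚ[k!]*inv!k≡1 : ∀ k → toℚ (k !) * inv! k ≡ 1ℚ
toℚ[k!]*inv!k≡1 k = toℚ*1/≡1 (k !) {{k ℕ.!≢0}}

Σ<-cong : ∀ k {f g : ℕ → ℚ} → (∀ i → i < k → f i ≡ g i) → Σ< k f ≡ Σ< k g
Σ<-cong zero    eq = refl
Σ<-cong (suc k) eq = cong₂ _+_ (Σ<-cong k (λ i i<k → eq i (ℕ.m<n⇒m<1+n i<k))) (eq k (ℕ.n<1+n k))

Σ<-vanish : ∀ k {f : ℕ → ℚ} → (∀ i → i < k → f i ≡ 0ℚ) → Σ< k f ≡ 0ℚ
Σ<-vanish zero    f≡0 = refl
Σ<-vanish (suc k) f≡0 = cong₂ _+_ (Σ<-vanish k (λ i i<k → f≡0 i (ℕ.m<n⇒m<1+n i<k))) (f≡0 k (ℕ.n<1+n k))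

Σ<-+ : ∀ k (f g : ℕ → ℚ) → Σ< k (λ i → f i + g i) ≡ Σ< k f + Σ< k g
Σ<-+ zero    f g = refl
Σ<-+ (suc k) f g = trans (cong (_+ (f k + g k)) (Σ<-+ k f g))
  (solve 4 (λ a b c d → (a :+ b) :+ (c :+ d) := (a :+ c) :+ (b :+ d)) refl (Σ< k f) (Σ< k g) (f k) (g k))

*-Σ< : ∀ k c (f : ℕ → ℚ) → c * Σ< k f ≡ Σ< k (λ i → c * f i)
*-Σ< zero    c f = *-zeroʳ c
*-Σ< (suc k) c f = trans (*-distribˡ-+ c (Σ< k f) (f k)) (cong (_+ c * f k) (*-Σ< k c f))

Σ<-* : ∀ k c (f : ℕ → ℚ) → Σ< k f * c ≡ Σ< k (λ i → f i * c)
Σ<-* zero    c f = *-zeroˡ c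
Σ<-* (suc k) c f = trans (*-distribʳ-+ c (Σ< k f) (f k)) (cong (_+ f k * c) (Σ<-* k c f))

Σ<-split : ∀ p q (f : ℕ → ℚ) → Σ< (p ℕ.+ q) f ≡ Σ< p f + Σ< q (λ i → f (p ℕ.+ i))
Σ<-split p zero    f rewrite ℕ.+-identityʳ p = sym (+-identityʳ (Σ< p f))
Σ<-split p (suc q) f rewrite ℕ.+-suc p q =
  trans (cong (_+ f (p ℕ.+ q)) (Σ<-split p q f)) (+-assoc (Σ< p f) _ (f (p ℕ.+ q)))

Σ<-head : ∀ k (f : ℕ → ℚ) → Σ< (suc k) f ≡ f 0 + Σ< k (λ i → f (suc i))
Σ<-head k f = trans (Σ<-split 1 k f) (cong (_+ Σ< k (λ i → f (suc i))) (+-identityˡ (f 0)))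

Σ<-head₂ : ∀ k (f : ℕ → ℚ) → Σ< (suc (suc k)) f ≡ f 0 + (f 1 + Σ< k (λ i → f (suc (suc i))))
Σ<-head₂ k f = trans (Σ<-head (suc k) f) (cong (f 0 +_) (Σ<-head k (λ i → f (suc i))))

Σ<-first-two : ∀ k (f : ℕ → ℚ) → (∀ i → f (suc (suc i)) ≡ 0ℚ) → Σ< (suc (suc k)) f ≡ f 0 + f 1
Σ<-first-two k f f≡0 = trans (Σ<-head₂ k f)
  (cong (f 0 +_) (trans (cong (f 1 +_) (Σ<-vanish k (λ i _ → f≡0 i))) (+-identityʳ (f 1))))

Σ<-*-Σ< : ∀ m n (f g : ℕ → ℚ) → Σ< m f * Σ< n g ≡ Σ< m (λ a → Σ< n (λ b → f a * g b))
Σ<-*-Σ< m n f g = trans (Σ<-* m (Σ< n g) f) (Σ<-cong m (λ a _ → *-Σ< n (f a) g))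

Σ<-truncate : ∀ {k M} (f : ℕ → ℚ) → k ≤ M → (∀ i → k ≤ i → f i ≡ 0ℚ) → Σ< M f ≡ Σ< k f
Σ<-truncate {k} {M} f k≤M f≡0 = begin
  Σ< M f
    ≡⟨ cong (λ n → Σ< n f) (sym (ℕ.m+[n∸m]≡n k≤M)) ⟩
  Σ< (k ℕ.+ (M ∸ k)) f
    ≡⟨ Σ<-split k (M ∸ k) f ⟩
  Σ< k f + Σ< (M ∸ k) (λ i → f (k ℕ.+ i))
    ≡⟨ cong (Σ< k f +_) (Σ<-vanish (M ∸ k) (λ i _ → f≡0 (k ℕ.+ i) (ℕ.m≤m+n k i))) ⟩
  Σ< k f + 0ℚ
    ≡⟨ +-identityʳ (Σ< k f) ⟩
  Σ< k f ∎
  where open ≡-Reasoning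

Σ<-comm : ∀ m n (f : ℕ → ℕ → ℚ) → Σ< m (λ i → Σ< n (f i)) ≡ Σ< n (λ j → Σ< m (λ i → f i j))
Σ<-comm zero    n f = sym (Σ<-vanish n (λ _ _ → refl))
Σ<-comm (suc m) n f = trans (cong (_+ Σ< n (f m)) (Σ<-comm m n f))
  (sym (Σ<-+ n (λ j → Σ< m (λ i → f i j)) (f m)))

Σ<-reverse : ∀ N (f : ℕ → ℚ) → Σ< (suc N) (λ i → f (N ∸ i)) ≡ Σ< (suc N) f
Σ<-reverse zero    f = refl
Σ<-reverse (suc N) f = begin
  Σ< (suc N) (λ i → f (suc N ∸ i)) + f (N ∸ N)
    ≡⟨ cong₂ _+_ (Σ<-cong (suc N) (λ i i≤N → cong f (ℕ.+-∸-assoc 1 (ℕ.s≤s⁻¹ i≤N)))) (cong f (ℕ.n∸n≡0 N)) ⟩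
  Σ< (suc N) (λ i → f (suc (N ∸ i))) + f 0
    ≡⟨ cong (_+ f 0) (Σ<-reverse N (λ j → f (suc j))) ⟩
  Σ< (suc N) (λ i → f (suc i)) + f 0
    ≡⟨ +-comm _ (f 0) ⟩
  f 0 + Σ< (suc N) (λ i → f (suc i))
    ≡⟨ sym (Σ<-head (suc N) f) ⟩
  Σ< (suc (suc N)) f ∎
  where open ≡-Reasoning

_⋆_ : (ℕ → ℚ) → (ℕ → ℚ) → ℕ → ℚ
(f ⋆ g) N = Σ< (suc N) (λ i → f (N ∸ i) * g i)

⋆-comm : ∀ f g N → (f ⋆ g) N ≡ (g ⋆ f) N
⋆-comm f g N = begin
  Σ< (suc N) (λ i → f (N ∸ i) * g i)              ≡⟨ Σ<-reverse N (λ i → f (N ∸ i) * g i) ⟨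
  Σ< (suc N) (λ i → f (N ∸ (N ∸ i)) * g (N ∸ i))  ≡⟨ Σ<-cong (suc N) (λ i i≤N →
                                                      trans (cong (λ k → f k * g (N ∸ i)) (ℕ.m∸[m∸n]≡n (ℕ.s≤s⁻¹ i≤N)))
                                                            (*-comm (f i) (g (N ∸ i)))) ⟩
  Σ< (suc N) (λ i → g (N ∸ i) * f i)              ∎
  where open ≡-Reasoning

Σ<-antidiagonal : ∀ M (g : ℕ → ℕ → ℚ) (E : ℕ → ℚ) → (∀ s → M ≤ s → E s ≡ 0ℚ) →
  Σ< M (λ a → Σ< M (λ b → g a b * E (a ℕ.+ b))) ≡ Σ< M (λ s → Σ< (suc s) (λ a → g a (s ∸ a)) * E s)
Σ<-antidiagonal M g E E≡0 = begin
  Σ< M (λ a → Σ< M (λ b → g a b * E (a ℕ.+ b)))     ≡⟨ Σ<-cong M row ⟩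
  Σ< M (λ a → Σ< M (d a))                           ≡⟨ Σ<-comm M M d ⟩
  Σ< M (λ s → Σ< M (λ a → d a s))                   ≡⟨ Σ<-cong M column ⟩
  Σ< M (λ s → Σ< (suc s) (λ a → g a (s ∸ a)) * E s) ∎
  where
  open ≡-Reasoning

  d : ℕ → ℕ → ℚ
  d a s with a ≤? s
  ... | yes _ = g a (s ∸ a) * E s
  ... | no  _ = 0ℚ

  d-≤ : ∀ {a s} → a ≤ s → d a s ≡ g a (s ∸ a) * E s
  d-≤ {a} {s} a≤s with a ≤? s
  ... | yes _   = refl
  ... | no  a≰s = contradiction a≤s a≰s

  d-> : ∀ {a s} → s < a → d a s ≡ 0ℚ
  d-> {a} {s} s<a with a ≤? s
  ... | yes a≤s = contradiction a≤s (ℕ.<⇒≱ s<a)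
  ... | no  _   = refl

  row : ∀ a → a < M → Σ< M (λ b → g a b * E (a ℕ.+ b)) ≡ Σ< M (d a)
  row a a<M = begin
    Σ< M (λ b → g a b * E (a ℕ.+ b))
      ≡⟨ Σ<-truncate _ (ℕ.m∸n≤m M a) (λ b M∸a≤b → trans
           (cong (g a b *_) (E≡0 (a ℕ.+ b) (ℕ.≤-trans (ℕ.m≤n+m∸n M a) (ℕ.+-monoʳ-≤ a M∸a≤b))))
           (*-zeroʳ (g a b))) ⟩
    Σ< (M ∸ a) (λ b → g a b * E (a ℕ.+ b))
      ≡⟨ Σ<-cong (M ∸ a) (λ j _ → sym (trans (d-≤ (ℕ.m≤m+n a j))
           (cong (λ k → g a k * E (a ℕ.+ j)) (ℕ.m+n∸m≡n a j)))) ⟩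
    Σ< (M ∸ a) (λ j → d a (a ℕ.+ j))
      ≡⟨ sym (+-identityˡ _) ⟩
    0ℚ + Σ< (M ∸ a) (λ j → d a (a ℕ.+ j))
      ≡⟨ cong (_+ Σ< (M ∸ a) (λ j → d a (a ℕ.+ j))) (sym (Σ<-vanish a (λ s s<a → d-> s<a))) ⟩
    Σ< a (d a) + Σ< (M ∸ a) (λ j → d a (a ℕ.+ j))
      ≡⟨ sym (Σ<-split a (M ∸ a) (d a)) ⟩
    Σ< (a ℕ.+ (M ∸ a)) (d a)
      ≡⟨ cong (λ n → Σ< n (d a)) (ℕ.m+[n∸m]≡n (ℕ.<⇒≤ a<M)) ⟩
    Σ< M (d a) ∎

  column : ∀ s → s < M → Σ< M (λ a → d a s) ≡ Σ< (suc s) (λ a → g a (s ∸ a)) * E s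
  column s s<M = begin
    Σ< M (λ a → d a s)                     ≡⟨ Σ<-truncate (λ a → d a s) s<M (λ a s<a → d-> s<a) ⟩
    Σ< (suc s) (λ a → d a s)               ≡⟨ Σ<-cong (suc s) (λ a a<1+s → d-≤ (ℕ.s≤s⁻¹ a<1+s)) ⟩
    Σ< (suc s) (λ a → g a (s ∸ a) * E s)   ≡⟨ sym (Σ<-* (suc s) (E s) (λ a → g a (s ∸ a))) ⟩
    Σ< (suc s) (λ a → g a (s ∸ a)) * E s   ∎

toℚ-C-vanish : ∀ {n k} → n < k → toℚ (n C k) ≡ 0ℚ
toℚ-C-vanish n<k = cong toℚ (k>n⇒nCk≡0 n<k)

toℚ-pascal : ∀ n k → toℚ (suc n C suc k) ≡ toℚ (n C k) + toℚ (n C suc k)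
toℚ-pascal n k = trans (cong toℚ (sym (nCk+nC[k+1]≡[n+1]C[k+1] n k))) (toℚ-+ (n C k) (n C suc k))

Σ<-iCc : ∀ n c → Σ< (suc n) (λ i → toℚ (i C c)) ≡ toℚ (suc n C suc c)
Σ<-iCc zero    zero    = refl
Σ<-iCc zero    (suc c) = refl
Σ<-iCc (suc n) c       = begin
  Σ< (suc n) (λ i → toℚ (i C c)) + toℚ (suc n C c)  ≡⟨ cong (_+ toℚ (suc n C c)) (Σ<-iCc n c) ⟩
  toℚ (suc n C suc c) + toℚ (suc n C c)             ≡⟨ +-comm (toℚ (suc n C suc c)) (toℚ (suc n C c)) ⟩
  toℚ (suc n C c) + toℚ (suc n C suc c)             ≡⟨ sym (toℚ-pascal (suc n) c) ⟩
  toℚ (suc (suc n) C suc c)                         ∎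
  where open ≡-Reasoning

Σ<-[n∸i]Ca*iCc : ∀ n a c →
  Σ< (suc n) (λ i → toℚ ((n ∸ i) C a) * toℚ (i C c)) ≡ toℚ (suc n C suc (c ℕ.+ a))
Σ<-[n∸i]Ca*iCc n zero c rewrite ℕ.+-identityʳ c =
  trans (Σ<-cong (suc n) (λ i _ → *-identityˡ (toℚ (i C c)))) (Σ<-iCc n c)
Σ<-[n∸i]Ca*iCc zero (suc a) c = trans (+-identityˡ _) (trans (*-zeroˡ (toℚ (0 C c)))
  (sym (toℚ-C-vanish (s≤s (ℕ.≤-trans (s≤s z≤n) (ℕ.m≤n+m (suc a) c))))))
Σ<-[n∸i]Ca*iCc (suc n) (suc a) c = begin
  Σ< (suc n) (λ i → toℚ ((suc n ∸ i) C suc a) * toℚ (i C c)) + toℚ ((n ∸ n) C suc a) * toℚ (suc n C c)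
    ≡⟨ cong₂ _+_ (Σ<-cong (suc n) (λ i i≤n → cong (λ k → toℚ (k C suc a) * toℚ (i C c)) (ℕ.+-∸-assoc 1 (ℕ.s≤s⁻¹ i≤n))))
                 (trans (cong (λ k → toℚ (k C suc a) * toℚ (suc n C c)) (ℕ.n∸n≡0 n)) (*-zeroˡ (toℚ (suc n C c)))) ⟩
  Σ< (suc n) (λ i → toℚ (suc (n ∸ i) C suc a) * toℚ (i C c)) + 0ℚ
    ≡⟨ +-identityʳ _ ⟩
  Σ< (suc n) (λ i → toℚ (suc (n ∸ i) C suc a) * toℚ (i C c))
    ≡⟨ Σ<-cong (suc n) (λ i _ → trans (cong (_* toℚ (i C c)) (toℚ-pascal (n ∸ i) a))
                                      (*-distribʳ-+ (toℚ (i C c)) (toℚ ((n ∸ i) C a)) (toℚ ((n ∸ i) C suc a)))) ⟩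
  Σ< (suc n) (λ i → toℚ ((n ∸ i) C a) * toℚ (i C c) + toℚ ((n ∸ i) C suc a) * toℚ (i C c))
    ≡⟨ Σ<-+ (suc n) _ _ ⟩
  Σ< (suc n) (λ i → toℚ ((n ∸ i) C a) * toℚ (i C c)) + Σ< (suc n) (λ i → toℚ ((n ∸ i) C suc a) * toℚ (i C c))
    ≡⟨ cong₂ _+_ (Σ<-[n∸i]Ca*iCc n a c) (Σ<-[n∸i]Ca*iCc n (suc a) c) ⟩
  toℚ (suc n C suc (c ℕ.+ a)) + toℚ (suc n C suc (c ℕ.+ suc a))
    ≡⟨ cong (λ k → toℚ (suc n C suc (c ℕ.+ a)) + toℚ (suc n C suc k)) (ℕ.+-suc c a) ⟩
  toℚ (suc n C suc (c ℕ.+ a)) + toℚ (suc n C suc (suc (c ℕ.+ a)))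
    ≡⟨ sym (toℚ-pascal (suc n) (suc (c ℕ.+ a))) ⟩
  toℚ (suc (suc n) C suc (suc (c ℕ.+ a)))
    ≡⟨ cong (λ k → toℚ (suc (suc n) C suc k)) (sym (ℕ.+-suc c a)) ⟩
  toℚ (suc (suc n) C suc (c ℕ.+ suc a)) ∎
  where open ≡-Reasoning

Σ<-sgn-telescope : ∀ k (f : ℕ → ℚ) → Σ< k (λ a → sgn (suc a) * (f a + f (suc a))) ≡ sgn k * f k - f 0
Σ<-sgn-telescope zero    f = solve 1 (λ p → con 0ℚ := con 1ℚ :* p :- p) refl (f 0)
Σ<-sgn-telescope (suc k) f = trans (cong (_+ sgn (suc k) * (f k + f (suc k))) (Σ<-sgn-telescope k f))
  (solve 4 (λ a σ b c → (σ :* b :- a) :+ (:- σ) :* (b :+ c) := (:- σ) :* c :- a) refl (f 0) (sgn k) (f k) (f (suc k)))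

Σ<-sgn*[1+s]Ca≡0 : ∀ s → Σ< (suc (suc s)) (λ a → sgn a * toℚ (suc s C a)) ≡ 0ℚ
Σ<-sgn*[1+s]Ca≡0 s = begin
  Σ< (suc (suc s)) (λ a → sgn a * toℚ (suc s C a))
    ≡⟨ Σ<-head (suc s) _ ⟩
  1ℚ * 1ℚ + Σ< (suc s) (λ a → sgn (suc a) * toℚ (suc s C suc a))
    ≡⟨ cong (1ℚ * 1ℚ +_) (Σ<-cong (suc s) (λ a _ → cong (sgn (suc a) *_) (toℚ-pascal s a))) ⟩
  1ℚ * 1ℚ + Σ< (suc s) (λ a → sgn (suc a) * (toℚ (s C a) + toℚ (s C suc a)))
    ≡⟨ cong (1ℚ * 1ℚ +_) (Σ<-sgn-telescope (suc s) (λ a → toℚ (s C a))) ⟩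
  1ℚ * 1ℚ + (sgn (suc s) * toℚ (s C suc s) - 1ℚ)
    ≡⟨ cong (λ t → 1ℚ * 1ℚ + (sgn (suc s) * t - 1ℚ)) (toℚ-C-vanish (ℕ.n<1+n s)) ⟩
  1ℚ * 1ℚ + (sgn (suc s) * 0ℚ - 1ℚ)
    ≡⟨ solve 1 (λ σ → con 1ℚ :* con 1ℚ :+ (σ :* con 0ℚ :- con 1ℚ) := con 0ℚ) refl (sgn (suc s)) ⟩
  0ℚ ∎
  where open ≡-Reasoning

nCk*[k!*[n∸k]!]≡n! : ∀ {n k} → k ≤ n → (n C k) ℕ.* (k ! ℕ.* (n ∸ k) !) ≡ n !
nCk*[k!*[n∸k]!]≡n! {n} {k} k≤n =
  trans (cong (ℕ._* (k ! ℕ.* (n ∸ k) !)) (nCk≡n!/k![n-k]! k≤n)) (m/n*n≡m (k![n∸k]!∣n! k≤n))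
  where instance _ = k ℕ.!* (n ∸ k) !≢0

inv!*inv!≡C*inv! : ∀ {n a} → a ≤ n → inv! a * inv! (n ∸ a) ≡ toℚ (n C a) * inv! n
inv!*inv!≡C*inv! {n} {a} a≤n = begin
  ia * ib
    ≡⟨ solve 2 (λ x y → x :* y := x :* y :* con 1ℚ) refl ia ib ⟩
  ia * ib * 1ℚ
    ≡⟨ cong (λ t → ia * ib * t) (sym (toℚ[k!]*inv!k≡1 n)) ⟩
  ia * ib * (toℚ (n !) * inv! n)
    ≡⟨ cong (λ m → ia * ib * (toℚ m * inv! n)) (sym (nCk*[k!*[n∸k]!]≡n! a≤n)) ⟩
  ia * ib * (toℚ ((n C a) ℕ.* (a ! ℕ.* (n ∸ a) !)) * inv! n)
    ≡⟨ cong (λ t → ia * ib * (t * inv! n)) (trans (toℚ-* (n C a) _) (cong (c *_) (toℚ-* (a !) ((n ∸ a) !)))) ⟩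
  ia * ib * (c * (A * B) * inv! n)
    ≡⟨ solve 6 (λ ia ib c A B i → ia :* ib :* (c :* (A :* B) :* i) := c :* i :* (A :* ia) :* (B :* ib)) refl ia ib c A B (inv! n) ⟩
  c * inv! n * (A * ia) * (B * ib)
    ≡⟨ cong₂ (λ u v → c * inv! n * u * v) (toℚ[k!]*inv!k≡1 a) (toℚ[k!]*inv!k≡1 (n ∸ a)) ⟩
  c * inv! n * 1ℚ * 1ℚ
    ≡⟨ solve 2 (λ x y → x :* y :* con 1ℚ :* con 1ℚ := x :* y) refl c (inv! n) ⟩
  c * inv! n ∎
  where
  open ≡-Reasoning
  ia = inv! a
  ib = inv! (n ∸ a)
  c  = toℚ (n C a)
  A  = toℚ (a !)
  B  = toℚ ((n ∸ a) !)

-- expCoeff a b = [yᵃ zᵇ] e^(−y) e^z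
expCoeff : ℕ → ℕ → ℚ
expCoeff a b = sgn a * inv! a * inv! b

Σ<-expCoeff-antidiagonal≡0 : ∀ s → Σ< (suc (suc s)) (λ a → expCoeff a (suc s ∸ a)) ≡ 0ℚ
Σ<-expCoeff-antidiagonal≡0 s = begin
  Σ< (suc (suc s)) (λ a → expCoeff a (suc s ∸ a))
    ≡⟨ Σ<-cong (suc (suc s)) (λ a a≤1+s → trans (*-assoc (sgn a) (inv! a) (inv! (suc s ∸ a)))
         (trans (cong (sgn a *_) (inv!*inv!≡C*inv! (ℕ.s≤s⁻¹ a≤1+s)))
           (solve 3 (λ x y z → x :* (y :* z) := z :* (x :* y)) refl (sgn a) (toℚ (suc s C a)) (inv! (suc s))))) ⟩
  Σ< (suc (suc s)) (λ a → inv! (suc s) * (sgn a * toℚ (suc s C a)))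
    ≡⟨ *-Σ< (suc (suc s)) (inv! (suc s)) _ ⟨
  inv! (suc s) * Σ< (suc (suc s)) (λ a → sgn a * toℚ (suc s C a))
    ≡⟨ cong (inv! (suc s) *_) (Σ<-sgn*[1+s]Ca≡0 s) ⟩
  inv! (suc s) * 0ℚ
    ≡⟨ *-zeroʳ (inv! (suc s)) ⟩
  0ℚ ∎
  where open ≡-Reasoning

-- powCoeff N s = [tᴺ] (t/(1−t))ˢ, that is C(N−1, s−1) when N, s ≥ 1
powCoeff : ℕ → ℕ → ℚ
powCoeff zero    zero    = 1ℚ
powCoeff zero    (suc s) = 0ℚ
powCoeff (suc N) zero    = 0ℚ
powCoeff (suc N) (suc s) = toℚ (N C s)

-- 𝓛-coeff i b = b! · [xᵇ] 𝓛ᵢ(x)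
𝓛-coeff : ℕ → ℕ → ℚ
𝓛-coeff zero                zero                = 1ℚ
𝓛-coeff zero                (suc b)             = 0ℚ
𝓛-coeff (suc zero)          zero                = - 1ℚ
𝓛-coeff (suc zero)          (suc zero)          = 1ℚ
𝓛-coeff (suc zero)          (suc (suc b))       = 0ℚ
𝓛-coeff (suc (suc k))       zero                = 0ℚ
𝓛-coeff (suc (suc k))       (suc zero)          = 0ℚ
𝓛-coeff (suc (suc k))       (suc (suc b))       = toℚ (k C b)

powCoeff-vanish : ∀ {N s} → N < s → powCoeff N s ≡ 0ℚ
powCoeff-vanish {zero}  {suc s} _           = refl
powCoeff-vanish {suc N} {suc s} (s≤s N<s)   = toℚ-C-vanish N<s

𝓛-coeff-vanish : ∀ {i b} → i < b → 𝓛-coeff i b ≡ 0ℚ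
𝓛-coeff-vanish {zero}        {suc b}       _                 = refl
𝓛-coeff-vanish {suc zero}    {suc zero}    (s≤s ())
𝓛-coeff-vanish {suc zero}    {suc (suc b)} _                 = refl
𝓛-coeff-vanish {suc (suc k)} {suc (suc b)} (s≤s (s≤s k<b))   = toℚ-C-vanish k<b

Σ<-C*𝓛-coeff : ∀ N a b → Σ< (suc N) (λ i → toℚ ((N ∸ i) C a) * 𝓛-coeff i b) ≡ powCoeff N (b ℕ.+ a)
Σ<-C*𝓛-coeff zero    zero    zero = refl
Σ<-C*𝓛-coeff zero    (suc a) zero = refl
Σ<-C*𝓛-coeff (suc N) a       zero =
  trans (Σ<-first-two N _ (λ i → *-zeroʳ (toℚ ((N ∸ suc i) C a)))) (leading a)
  where
  leading : ∀ k → toℚ (suc N C k) * 1ℚ + toℚ (N C k) * - 1ℚ ≡ powCoeff (suc N) k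
  leading zero    = refl
  leading (suc k) = trans (cong (λ t → t * 1ℚ + toℚ (N C suc k) * - 1ℚ) (toℚ-pascal N k))
    (solve 2 (λ p q → (p :+ q) :* con 1ℚ :+ q :* con (- 1ℚ) := p) refl (toℚ (N C k)) (toℚ (N C suc k)))
Σ<-C*𝓛-coeff zero    a (suc zero) = trans (+-identityˡ _) (*-zeroʳ (toℚ (0 C a)))
Σ<-C*𝓛-coeff (suc N) a (suc zero) =
  trans (Σ<-first-two N _ (λ i → *-zeroʳ (toℚ ((N ∸ suc i) C a))))
        (solve 2 (λ p q → p :* con 0ℚ :+ q :* con 1ℚ := q) refl (toℚ (suc N C a)) (toℚ (N C a)))
Σ<-C*𝓛-coeff zero          a (suc (suc c)) = trans (+-identityˡ _) (*-zeroʳ (toℚ (0 C a)))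
Σ<-C*𝓛-coeff (suc zero)    a (suc (suc c)) =
  solve 2 (λ p q → con 0ℚ :+ p :* con 0ℚ :+ q :* con 0ℚ := con 0ℚ) refl (toℚ (1 C a)) (toℚ (0 C a))
Σ<-C*𝓛-coeff (suc (suc M)) a (suc (suc c)) = begin
  Σ< (suc (suc (suc M))) f                          ≡⟨ Σ<-head₂ (suc M) f ⟩
  f 0 + (f 1 + Σ< (suc M) (λ i → f (suc (suc i))))  ≡⟨ cong (λ t → f 0 + (f 1 + t)) (Σ<-[n∸i]Ca*iCc M a c) ⟩
  f 0 + (f 1 + toℚ (suc M C suc (c ℕ.+ a)))         ≡⟨ solve 3 (λ p q r → p :* con 0ℚ :+ (q :* con 0ℚ :+ r) := r) refl
                                                         (toℚ (suc (suc M) C a)) (toℚ (suc M C a)) (toℚ (suc M C suc (c ℕ.+ a))) ⟩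
  toℚ (suc M C suc (c ℕ.+ a))                       ∎
  where
  open ≡-Reasoning
  f : ℕ → ℚ
  f i = toℚ ((suc (suc M) ∸ i) C a) * 𝓛-coeff i (suc (suc c))

^-+ : ∀ x m n → x ^ (m ℕ.+ n) ≡ x ^ m * x ^ n
^-+ x zero    n = sym (*-identityˡ (x ^ n))
^-+ x (suc m) n = trans (cong (x *_) (^-+ x m n)) (sym (*-assoc x (x ^ m) (x ^ n)))

module _ (x : ℚ) where

  L-term : ℕ → ℕ → ℚ
  L-term n a = sgn a * toℚ (n C a) * x ^ a * inv! a

  𝓛-term : ℕ → ℕ → ℚ
  𝓛-term i b = 𝓛-coeff i b * inv! b * x ^ b

  L≡Σ<L-term : ∀ {n M} → n < M → L n x ≡ Σ< M (L-term n)
  L≡Σ<L-term {n} n<M = sym (Σ<-truncate (L-term n) n<M (λ a n<a →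
    trans (cong (λ c → sgn a * c * x ^ a * inv! a) (toℚ-C-vanish n<a))
          (solve 3 (λ σ p q → σ :* con 0ℚ :* p :* q := con 0ℚ) refl (sgn a) (x ^ a) (inv! a))))

  𝓛≡Σ<[1+i]𝓛-term : ∀ i → 𝓛 i x ≡ Σ< (suc i) (𝓛-term i)
  𝓛≡Σ<[1+i]𝓛-term zero                = refl
  𝓛≡Σ<[1+i]𝓛-term (suc zero)          =
    solve 1 (λ y → y :- con 1ℚ := con 0ℚ :+ con (- 1ℚ) :* con 1ℚ :* con 1ℚ :+ con 1ℚ :* con 1ℚ :* (y :* con 1ℚ)) refl x
  𝓛≡Σ<[1+i]𝓛-term (suc (suc k))       = sym (begin
    Σ< (suc (suc (suc k))) (𝓛-term (suc (suc k)))
      ≡⟨ Σ<-head₂ (suc k) (𝓛-term (suc (suc k))) ⟩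
    0ℚ * 1ℚ * 1ℚ + (0ℚ * 1ℚ * (x * 1ℚ) + Σ< (suc k) (λ j → toℚ (k C j) * inv! (2 ℕ.+ j) * x ^ (2 ℕ.+ j)))
      ≡⟨ solve 2 (λ y t → con 0ℚ :* con 1ℚ :* con 1ℚ :+ (con 0ℚ :* con 1ℚ :* (y :* con 1ℚ) :+ t) := t) refl x _ ⟩
    Σ< (suc k) (λ j → toℚ (k C j) * inv! (2 ℕ.+ j) * x ^ (2 ℕ.+ j))
      ≡⟨ Σ<-cong (suc k) (λ j _ → solve 3 (λ c i p → c :* i :* p := c :* p :* i) refl
                                    (toℚ (k C j)) (inv! (2 ℕ.+ j)) (x ^ (2 ℕ.+ j))) ⟩
    𝓛 (suc (suc k)) x ∎)
    where open ≡-Reasoning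

  𝓛≡Σ<𝓛-term : ∀ {i M} → i < M → 𝓛 i x ≡ Σ< M (𝓛-term i)
  𝓛≡Σ<𝓛-term {i} i<M = trans (𝓛≡Σ<[1+i]𝓛-term i) (sym (Σ<-truncate (𝓛-term i) i<M (λ b i<b →
    trans (cong (λ c → c * inv! b * x ^ b) (𝓛-coeff-vanish i<b))
          (trans (cong (_* x ^ b) (*-zeroˡ (inv! b))) (*-zeroˡ (x ^ b))))))

  Σ<-L-term*𝓛-term : ∀ N a b → Σ< (suc N) (λ i → L-term (N ∸ i) a * 𝓛-term i b)
    ≡ expCoeff a b * (powCoeff N (a ℕ.+ b) * x ^ (a ℕ.+ b))
  Σ<-L-term*𝓛-term N a b = begin
    Σ< (suc N) (λ i → L-term (N ∸ i) a * 𝓛-term i b)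
      ≡⟨ Σ<-cong (suc N) (λ i _ → solve 7 (λ σ c xa ia γ ib xb → σ :* c :* xa :* ia :* (γ :* ib :* xb)
                                                            := σ :* ia :* ib :* (xa :* xb) :* (c :* γ))
           refl (sgn a) (toℚ ((N ∸ i) C a)) (x ^ a) (inv! a) (𝓛-coeff i b) (inv! b) (x ^ b)) ⟩
    Σ< (suc N) (λ i → w * (x ^ a * x ^ b) * (toℚ ((N ∸ i) C a) * 𝓛-coeff i b))
      ≡⟨ sym (*-Σ< (suc N) (w * (x ^ a * x ^ b)) _) ⟩
    w * (x ^ a * x ^ b) * Σ< (suc N) (λ i → toℚ ((N ∸ i) C a) * 𝓛-coeff i b)
      ≡⟨ cong₂ (λ p q → w * p * q) (sym (^-+ x a b)) (trans (Σ<-C*𝓛-coeff N a b) (cong (powCoeff N) (ℕ.+-comm b a))) ⟩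
    w * x ^ (a ℕ.+ b) * powCoeff N (a ℕ.+ b)
      ≡⟨ solve 3 (λ p q r → p :* q :* r := p :* (r :* q)) refl w (x ^ (a ℕ.+ b)) (powCoeff N (a ℕ.+ b)) ⟩
    w * (powCoeff N (a ℕ.+ b) * x ^ (a ℕ.+ b)) ∎
    where
    open ≡-Reasoning
    w = expCoeff a b

  L⋆𝓛≡powCoeff0 : ∀ N → ((λ k → L k x) ⋆ (λ k → 𝓛 k x)) N ≡ powCoeff N 0
  L⋆𝓛≡powCoeff0 N = begin
    Σ< M (λ i → L (N ∸ i) x * 𝓛 i x)
      ≡⟨ Σ<-cong M (λ i i<M → cong₂ _*_ (L≡Σ<L-term (s≤s (ℕ.m∸n≤m N i))) (𝓛≡Σ<𝓛-term i<M)) ⟩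
    Σ< M (λ i → Σ< M (L-term (N ∸ i)) * Σ< M (𝓛-term i))
      ≡⟨ Σ<-cong M (λ i _ → Σ<-*-Σ< M M (L-term (N ∸ i)) (𝓛-term i)) ⟩
    Σ< M (λ i → Σ< M (λ a → Σ< M (λ b → L-term (N ∸ i) a * 𝓛-term i b)))
      ≡⟨ Σ<-comm M M _ ⟩
    Σ< M (λ a → Σ< M (λ i → Σ< M (λ b → L-term (N ∸ i) a * 𝓛-term i b)))
      ≡⟨ Σ<-cong M (λ a _ → Σ<-comm M M (λ i b → L-term (N ∸ i) a * 𝓛-term i b)) ⟩
    Σ< M (λ a → Σ< M (λ b → Σ< M (λ i → L-term (N ∸ i) a * 𝓛-term i b)))
      ≡⟨ Σ<-cong M (λ a _ → Σ<-cong M (λ b _ → Σ<-L-term*𝓛-term N a b)) ⟩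
    Σ< M (λ a → Σ< M (λ b → expCoeff a b * E (a ℕ.+ b)))
      ≡⟨ Σ<-antidiagonal M expCoeff E (λ s M≤s → trans (cong (_* x ^ s) (powCoeff-vanish M≤s)) (*-zeroˡ (x ^ s))) ⟩
    Σ< M (λ s → Σ< (suc s) (λ a → expCoeff a (s ∸ a)) * E s)
      ≡⟨ Σ<-head N _ ⟩
    (0ℚ + expCoeff 0 0) * E 0 + Σ< N (λ s → Σ< (suc (suc s)) (λ a → expCoeff a (suc s ∸ a)) * E (suc s))
      ≡⟨ cong ((0ℚ + expCoeff 0 0) * E 0 +_) (Σ<-vanish N (λ s _ →
           trans (cong (_* E (suc s)) (Σ<-expCoeff-antidiagonal≡0 s)) (*-zeroˡ (E (suc s))))) ⟩
    (0ℚ + expCoeff 0 0) * E 0 + 0ℚ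
      ≡⟨ solve 1 (λ c → (con 0ℚ :+ con 1ℚ) :* (c :* con 1ℚ) :+ con 0ℚ := c) refl (powCoeff N 0) ⟩
    powCoeff N 0 ∎
    where
    open ≡-Reasoning
    M = suc N
    E : ℕ → ℚ
    E s = powCoeff N s * x ^ s

Σ[]-shift : ∀ {m n} (h : ℕ → ℚ) → m ≤ n → Σ[ m to n ] h ≡ Σ< (suc (n ∸ m)) (λ i → h (m ℕ.+ i))
Σ[]-shift {m} {n} h m≤n with m ≤? n
... | yes _   = refl
... | no  m≰n = contradiction m≤n m≰n

Σ[]-cong : ∀ m n {h h′ : ℕ → ℚ} → (∀ j → m ≤ j → j ≤ n → h j ≡ h′ j) → Σ[ m to n ] h ≡ Σ[ m to n ] h′
Σ[]-cong m n eq with m ≤? n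
... | no  _   = refl
... | yes m≤n = Σ<-cong (suc (n ∸ m)) (λ i i≤n∸m → eq (m ℕ.+ i) (ℕ.m≤m+n m i)
  (ℕ.≤-trans (ℕ.+-monoʳ-≤ m (ℕ.s≤s⁻¹ i≤n∸m)) (ℕ.≤-reflexive (ℕ.m+[n∸m]≡n m≤n))))

Σ[]-⋆ : ∀ (f g : ℕ → ℚ) {m n} → m ≤ n → Σ[ m to n ] (λ j → f (n ∸ j) * g (j ∸ m)) ≡ (f ⋆ g) (n ∸ m)
Σ[]-⋆ f g {m} {n} m≤n = trans (Σ[]-shift _ m≤n) (Σ<-cong (suc (n ∸ m)) (λ i _ →
  cong₂ (λ p q → f p * g q) (sym (ℕ.∸-+-assoc n m i)) (ℕ.m+n∸m≡n m i)))

toeplitz-≤ : ∀ f {n j} → j ≤ n → toeplitz f n j ≡ f (n ∸ j)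
toeplitz-≤ f {n} {j} j≤n with j ≤? n
... | yes _   = refl
... | no  j≰n = contradiction j≤n j≰n

toeplitz-⊗ : ∀ f g {n m} → m ≤ n → (toeplitz f ⊗ toeplitz g) n m ≡ (f ⋆ g) (n ∸ m)
toeplitz-⊗ f g {n} {m} m≤n = trans
  (Σ[]-cong m n (λ j m≤j j≤n → cong₂ _*_ (toeplitz-≤ f j≤n) (toeplitz-≤ g m≤j)))
  (Σ[]-⋆ f g m≤n)

powCoeff[N,0]≡0 : ∀ {N} → 0 < N → powCoeff N 0 ≡ 0ℚ
powCoeff[N,0]≡0 {suc N} _ = refl

I≡powCoeff[n∸m]0 : ∀ {n m} → m ≤ n → I n m ≡ powCoeff (n ∸ m) 0
I≡powCoeff[n∸m]0 {n} {m} m≤n with n ℕ.≟ m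
... | yes refl = cong (λ k → powCoeff k 0) (sym (ℕ.n∸n≡0 n))
... | no  n≢m  = sym (powCoeff[N,0]≡0 (ℕ.m<n⇒0<n∸m (ℕ.≤∧≢⇒< m≤n (n≢m ∘ sym))))

proposition4 : (x : ℚ) →
    ((n m : ℕ) → m < n → Σ[ m to n ] (λ j → L (n ∸ j) x * 𝓛 (j ∸ m) x) ≡ 0ℚ)
    × IsInverse (toeplitz (λ k → L k x)) (toeplitz (λ k → 𝓛 k x))
proposition4 x = orthogonality , L⊗𝓛≐I , 𝓛⊗L≐I
  where
  Lₓ 𝓛ₓ : ℕ → ℚ
  Lₓ k = L k x
  𝓛ₓ k = 𝓛 k x

  orthogonality : (n m : ℕ) → m < n → Σ[ m to n ] (λ j → L (n ∸ j) x * 𝓛 (j ∸ m) x) ≡ 0ℚ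
  orthogonality n m m<n = begin
    Σ[ m to n ] (λ j → L (n ∸ j) x * 𝓛 (j ∸ m) x)   ≡⟨ Σ[]-⋆ Lₓ 𝓛ₓ (ℕ.<⇒≤ m<n) ⟩
    (Lₓ ⋆ 𝓛ₓ) (n ∸ m)                               ≡⟨ L⋆𝓛≡powCoeff0 x (n ∸ m) ⟩
    powCoeff (n ∸ m) 0                              ≡⟨ powCoeff[N,0]≡0 (ℕ.m<n⇒0<n∸m m<n) ⟩
    0ℚ                                              ∎
    where open ≡-Reasoning

  L⊗𝓛≐I : (toeplitz Lₓ ⊗ toeplitz 𝓛ₓ) ≐ I
  L⊗𝓛≐I n m m≤n = begin
    (toeplitz Lₓ ⊗ toeplitz 𝓛ₓ) n m  ≡⟨ toeplitz-⊗ Lₓ 𝓛ₓ m≤n ⟩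
    (Lₓ ⋆ 𝓛ₓ) (n ∸ m)                ≡⟨ L⋆𝓛≡powCoeff0 x (n ∸ m) ⟩
    powCoeff (n ∸ m) 0               ≡⟨ I≡powCoeff[n∸m]0 m≤n ⟨
    I n m                            ∎
    where open ≡-Reasoning

  𝓛⊗L≐I : (toeplitz 𝓛ₓ ⊗ toeplitz Lₓ) ≐ I
  𝓛⊗L≐I n m m≤n = begin
    (toeplitz 𝓛ₓ ⊗ toeplitz Lₓ) n m  ≡⟨ toeplitz-⊗ 𝓛ₓ Lₓ m≤n ⟩
    (𝓛ₓ ⋆ Lₓ) (n ∸ m)                ≡⟨ ⋆-comm 𝓛ₓ Lₓ (n ∸ m) ⟩
    (Lₓ ⋆ 𝓛ₓ) (n ∸ m)                ≡⟨ L⋆𝓛≡powCoeff0 x (n ∸ m) ⟩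
    powCoeff (n ∸ m) 0               ≡⟨ I≡powCoeff[n∸m]0 m≤n ⟨
    I n m                            ∎
    where open ≡-Reasoning
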